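{- Let $k\ge 3$, $0<i<n$, and suppose $W^{(k)}_n[t,t+1]=i0$ for some positive integer $t$. Then $W^{(k)}_n[t-|W^{(k)}_i|+1,t+1]=W^{(k)}_i0$; that is, this occurrence of the digit $i$ is the last digit of an occurrence of $W^{(k)}_i$ in $W^{(k)}_n$.
   Context: Words are over $\mathbb{N}$. Define the morphism $\varphi_k$ by $\varphi_k(ki+j)=(ki)(ki+j+1)$ if $0\le j\le k-2$ and $\varphi_k(ki+j)=(ki+j+1)$ if $j=k-1$; let $W^{(k)}_n=\varphi_k^n(0)$. For a word $W=w_1w_2\cdots w_p$ and $1\le j\le j'\le p$, $W[j,j']=w_j\cdots w_{j'}$. -}

module Defs where

open import Data.Nat using (ℕ; zero; suc; _+_; _∸_; _≤_; _<_; NonZero)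
open import Data.Nat.DivMod using (_%_)
open import Data.Nat.Properties using (_<?_)
open import Data.List using (List; []; _∷_; _++_; concatMap; take; drop; length)
open import Data.Maybe using (Maybe)
open import Relation.Nullary using (yes; no)

Word : Set
Word = List ℕ

-- The morphism φ_k on a letter m = k*i + j (0 ≤ j ≤ k-1):
--   φ_k(m) = (m - j) (m + 1)   if j ≤ k - 2, i.e. j + 1 < k
--   φ_k(m) = (m + 1)           if j = k - 1
φ-letter : (k : ℕ) →  ℕ → Word
-- (k = 0 is never used; the statement assumes k ≥ 3. We return the letter unchanged.)
φ-letter zero m = m ∷ []
φ-letter k@(suc _) m with suc (m % k) <? k
... | yes _ = (m ∸ (m % k)) ∷ suc m ∷ []
... | no  _ = suc m ∷ []

φ : (k : ℕ) → Word → Word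
φ k w = concatMap (φ-letter k) w

φ^ : (k : ℕ) → ℕ → Word → Word
φ^ k zero    w = w
φ^ k (suc n) w = φ k (φ^ k n w)

W : (k : ℕ) → ℕ → Word
W k n = φ^ k n (0 ∷ [])

-- Factor W[j, j'] = w_j ... w_{j'} (1-indexed, inclusive), meaningful when 1 ≤ j ≤ j' ≤ |W|.
factor : Word → ℕ → ℕ → Word
factor w j j' = take (suc (j' ∸ j)) (drop (j ∸ 1) w)

-- Every block φ(x) ends with the letter x + 1, and a block φ(y) starts with
-- k⌊y/k⌋ or y + 1, so it starts with a letter < k only when y < k. Hence in W_{n+1} = φ(W_n) a
-- positive letter i followed by a letter < k ends a block φ(i − 1) followed by a block φ(y) with
-- y < k; it cannot be the first letter of a block [k⌊x/k⌋, x + 1], since x + 1 < k forces that letter to be 0.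
-- So in W_n the letter i − 1 is followed by y < k; by induction it ends an occurrence of W_{i−1},
-- and applying φ, the letter i ends an occurrence of φ(W_{i−1}) = W_i. The digit 0 after i is < k.

module Submission where

open import Defs
open import Data.Nat using (ℕ; zero; suc; _+_; _∸_; _*_; _≤_; _<_; NonZero; z≤n; s≤s)
open import Data.Nat.DivMod using (_%_; _/_; m≡m%n+[m/n]*n; m<n⇒m%n≡m; m/n≡0⇒m<n)
open import Data.Nat.Properties
open import Data.List using (List; []; _∷_; _++_; _∷ʳ_; length; take; drop; concatMap)
open import Data.List.Properties
  using (∷-injectiveˡ; ∷-injectiveʳ; ∷ʳ-injectiveʳ; length-++; ++-assoc; ++-identityʳ; concatMap-++; take++drop≡id)
open import Data.Product using (_×_; _,_; ∃-syntax)
open import Data.Sum using (_⊎_; inj₁; inj₂)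
open import Data.Empty using (⊥-elim)
open import Relation.Nullary using (yes; no)
open import Relation.Binary.PropositionalEquality

m∸m%n<n⇒m<n : ∀ {m n} .{{_ : NonZero n}} → m ∸ m % n < n → m < n
m∸m%n<n⇒m<n {m} {n} lt = m/n≡0⇒m<n (n<1⇒n≡0 (*-cancelʳ-< n (m / n) 1 [m/n]*n<1*n))
  where
  [m/n]*n<1*n : m / n * n < 1 * n
  [m/n]*n<1*n = begin-strict
    m / n * n                    ≡⟨ m+n∸m≡n (m % n) (m / n * n) ⟨
    m % n + m / n * n ∸ m % n    ≡⟨ cong (_∸ m % n) (m≡m%n+[m/n]*n m n) ⟨
    m ∸ m % n                    <⟨ lt ⟩
    n                            ≡⟨ *-identityˡ n ⟨
    1 * n                        ∎
    where open ≤-Reasoning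

module _ {A : Set} where

  [_]≢++∷∷ : ∀ (a : A) pre {b c r} → a ∷ [] ≢ pre ++ b ∷ c ∷ r
  [ a ]≢++∷∷ []          ()
  [ a ]≢++∷∷ (_ ∷ [])    ()
  [ a ]≢++∷∷ (_ ∷ _ ∷ _) ()

  ++-≡-++-∷ : ∀ (xs ys p : List A) {a r} → xs ++ ys ≡ p ++ a ∷ r →
              (∃[ p′ ] p ≡ xs ++ p′ × ys ≡ p′ ++ a ∷ r) ⊎ (∃[ r′ ] xs ≡ p ++ a ∷ r′ × r ≡ r′ ++ ys)
  ++-≡-++-∷ []       ys p       eq   = inj₁ (p , refl , eq)
  ++-≡-++-∷ (x ∷ xs) ys []      refl = inj₂ (xs , refl , refl)
  ++-≡-++-∷ (x ∷ xs) ys (_ ∷ p) eq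
    with refl ← ∷-injectiveˡ eq
    with ++-≡-++-∷ xs ys p (∷-injectiveʳ eq)
  ... | inj₁ (p′ , refl , eq′) = inj₁ (p′ , refl , eq′)
  ... | inj₂ (r′ , refl , eq′) = inj₂ (r′ , refl , eq′)

  drop-length-++ : ∀ (xs ys : List A) → drop (length xs) (xs ++ ys) ≡ ys
  drop-length-++ []       ys = refl
  drop-length-++ (x ∷ xs) ys = drop-length-++ xs ys

  take-suc-length-++ : ∀ (xs : List A) a ys → take (suc (length xs)) (xs ++ a ∷ ys) ≡ xs ∷ʳ a
  take-suc-length-++ []       a ys = refl
  take-suc-length-++ (x ∷ xs) a ys = cong (x ∷_) (take-suc-length-++ xs a ys)

  length-take-of-drop-∷ : ∀ n (xs : List A) {y ys} → drop n xs ≡ y ∷ ys → length (take n xs) ≡ n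
  length-take-of-drop-∷ zero    xs       _  = refl
  length-take-of-drop-∷ (suc n) (x ∷ xs) eq = cong suc (length-take-of-drop-∷ n xs eq)

module _ {A B : Set} (f : A → List B) where

  concatMap-≡-++-∷ : ∀ u p {b r} → concatMap f u ≡ p ++ b ∷ r →
    ∃[ u₁ ] ∃[ x ] ∃[ u₂ ] ∃[ pre ] ∃[ post ]
      u ≡ u₁ ++ x ∷ u₂ × p ≡ concatMap f u₁ ++ pre × f x ≡ pre ++ b ∷ post × r ≡ post ++ concatMap f u₂
  concatMap-≡-++-∷ [] []      ()
  concatMap-≡-++-∷ [] (_ ∷ _) ()
  concatMap-≡-++-∷ (x ∷ u) p eq with ++-≡-++-∷ (f x) (concatMap f u) p eq
  ... | inj₂ (post , fx≡ , refl) = [] , x , u , p , post , refl , refl , fx≡ , refl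
  ... | inj₁ (p′ , refl , eq′) with concatMap-≡-++-∷ u p′ eq′
  ...   | u₁ , y , u₂ , pre , post , refl , refl , fy≡ , refl =
          x ∷ u₁ , y , u₂ , pre , post , refl , sym (++-assoc (f x) (concatMap f u₁) pre) , fy≡ , refl

module _ (c : ℕ) where
  private
    k : ℕ
    k = suc c

  φ-letter-shape : ∀ x → φ-letter k x ≡ suc x ∷ [] ⊎ φ-letter k x ≡ x ∸ x % k ∷ suc x ∷ []
  φ-letter-shape x with suc (x % k) <? k
  ... | yes _ = inj₂ refl
  ... | no  _ = inj₁ refl

  φ-letter-last : ∀ x pre {i} → φ-letter k x ≡ pre ∷ʳ i → i ≡ suc x
  φ-letter-last x pre eq with φ-letter-shape x
  ... | inj₁ eq′ = ∷ʳ-injectiveʳ pre []      (trans (sym eq) eq′)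
  ... | inj₂ eq′ = ∷ʳ-injectiveʳ pre (_ ∷ []) (trans (sym eq) eq′)

  φ-letter-head-small : ∀ x r {m s} → φ-letter k x ++ r ≡ m ∷ s → m < k → x < k
  φ-letter-head-small x r eq m<k with φ-letter-shape x
  ... | inj₁ eq′ with refl ← ∷-injectiveˡ (trans (cong (_++ r) (sym eq′)) eq) = <-trans (n<1+n x) m<k
  ... | inj₂ eq′ with refl ← ∷-injectiveˡ (trans (cong (_++ r) (sym eq′)) eq) = m∸m%n<n⇒m<n m<k

  φ-letter-before-small≡0 : ∀ x pre {i m post} → φ-letter k x ≡ pre ++ i ∷ m ∷ post → m < k → i ≡ 0
  φ-letter-before-small≡0 x (_ ∷ pre) eq m<k with φ-letter-shape x
  ... | inj₁ eq′ = ⊥-elim ([ suc x ]≢++∷∷ (_ ∷ pre) (trans (sym eq′) eq))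
  ... | inj₂ eq′ = ⊥-elim ([ suc x ]≢++∷∷ pre (∷-injectiveʳ (trans (sym eq′) eq)))
  φ-letter-before-small≡0 x [] eq m<k with φ-letter-shape x
  ... | inj₁ eq′ = ⊥-elim ([ suc x ]≢++∷∷ [] (trans (sym eq′) eq))
  ... | inj₂ eq′ with refl ← trans (sym eq′) eq =
    trans (cong (x ∸_) (m<n⇒m%n≡m (<-trans (n<1+n x) m<k))) (n∸n≡0 x)

  φ-head-small : ∀ u {m s} → φ k u ≡ m ∷ s → m < k → ∃[ y ] ∃[ u′ ] u ≡ y ∷ u′ × y < k
  φ-head-small (y ∷ u) eq m<k = y , u , refl , φ-letter-head-small y (φ k u) eq m<k

  φ-preimage : ∀ u p {i m s} → φ k u ≡ p ++ i ∷ m ∷ s → 0 < i → m < k →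
    ∃[ u₁ ] ∃[ x ] ∃[ y ] ∃[ u₂ ]
      u ≡ u₁ ++ x ∷ y ∷ u₂ × φ k (u₁ ∷ʳ x) ≡ p ∷ʳ i × suc x ≡ i × y < k
  φ-preimage u p eq 0<i m<k with concatMap-≡-++-∷ (φ-letter k) u p eq
  ... | u₁ , x , u₂ , pre , _ ∷ post , _ , _ , fx≡ , m∷s≡
    with refl ← ∷-injectiveˡ m∷s≡
    = ⊥-elim (<⇒≢ 0<i (sym (φ-letter-before-small≡0 x pre fx≡ m<k)))
  ... | u₁ , x , u₂ , pre , [] , refl , refl , fx≡ , m∷s≡
    with φ-head-small u₂ (sym m∷s≡) m<k
  ...   | y , u₂′ , refl , y<k = u₁ , x , y , u₂′ , refl , image , sym (φ-letter-last x pre fx≡) , y<k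
    where
    open ≡-Reasoning
    image : φ k (u₁ ∷ʳ x) ≡ (φ k u₁ ++ pre) ∷ʳ _
    image = begin
      φ k (u₁ ∷ʳ x)                  ≡⟨ concatMap-++ (φ-letter k) u₁ (x ∷ []) ⟩
      φ k u₁ ++ φ-letter k x ++ []   ≡⟨ cong (φ k u₁ ++_) (++-identityʳ (φ-letter k x)) ⟩
      φ k u₁ ++ φ-letter k x         ≡⟨ cong (φ k u₁ ++_) fx≡ ⟩
      φ k u₁ ++ pre ∷ʳ _             ≡⟨ ++-assoc (φ k u₁) pre _ ⟨
      (φ k u₁ ++ pre) ∷ʳ _           ∎

  W-suffix : ∀ n p {i m s} → W k n ≡ p ++ i ∷ m ∷ s → m < k → ∃[ q ] p ∷ʳ i ≡ q ++ W k i
  W-suffix n       p {zero}  _  _   = p , refl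
  W-suffix zero    p {suc i} eq _   = ⊥-elim ([ 0 ]≢++∷∷ p eq)
  W-suffix (suc n) p {suc i} eq m<k with φ-preimage (W k n) p eq (s≤s z≤n) m<k
  ... | u₁ , x , y , u₂ , eq′ , image , refl , y<k with W-suffix n u₁ eq′ y<k
  ...   | q , ends = φ k q , (begin
          p ∷ʳ suc x           ≡⟨ image ⟨
          φ k (u₁ ∷ʳ x)        ≡⟨ cong (φ k) ends ⟩
          φ k (q ++ W k x)     ≡⟨ concatMap-++ (φ-letter k) q (W k x) ⟩
          φ k q ++ W k (suc x) ∎)
    where open ≡-Reasoning

factor-pair-split : ∀ t w {a b} → factor w (suc t) (suc t + 1) ≡ a ∷ b ∷ [] →
                    ∃[ p ] ∃[ s ] w ≡ p ++ a ∷ b ∷ s × length p ≡ t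
factor-pair-split t w {a} {b} eq
  with drop t w in drop≡ | subst (λ d → take (suc d) (drop t w) ≡ a ∷ b ∷ []) (m+n∸m≡n t 1) eq
... | _ ∷ _ ∷ s | refl =
  take t w , s , trans (sym (take++drop≡id t w)) (cong (take t w ++_) drop≡) , length-take-of-drop-∷ t w drop≡

factor-at : ∀ {w} q v {a r} → w ≡ q ++ v ++ a ∷ r →
            factor w (length q + length v ∸ length v + 1) (length q + length v + 1) ≡ v ∷ʳ a
factor-at {w} q v {a} {r} refl = begin
  take (suc (ℓ + 1 ∸ (ℓ ∸ length v + 1))) (drop (ℓ ∸ length v + 1 ∸ 1) w)
    ≡⟨ cong₂ (λ d e → take (suc d) (drop e w)) width start ⟩
  take (suc (length v)) (drop (length q) (q ++ v ++ a ∷ r))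
    ≡⟨ cong (take (suc (length v))) (drop-length-++ q (v ++ a ∷ r)) ⟩
  take (suc (length v)) (v ++ a ∷ r)
    ≡⟨ take-suc-length-++ v a r ⟩
  v ∷ʳ a ∎
  where
  open ≡-Reasoning
  ℓ : ℕ
  ℓ = length q + length v
  start : ℓ ∸ length v + 1 ∸ 1 ≡ length q
  start = trans (m+n∸n≡m (ℓ ∸ length v) 1) (m+n∸n≡m (length q) (length v))
  width : ℓ + 1 ∸ (ℓ ∸ length v + 1) ≡ length v
  width = begin
    ℓ + 1 ∸ (ℓ ∸ length v + 1)             ≡⟨ cong (λ j → ℓ + 1 ∸ (j + 1)) (m+n∸n≡m (length q) (length v)) ⟩
    length q + length v + 1 ∸ (length q + 1) ≡⟨ cong (_∸ (length q + 1)) (+-assoc (length q) (length v) 1) ⟩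
    length q + (length v + 1) ∸ (length q + 1) ≡⟨ [m+n]∸[m+o]≡n∸o (length q) (length v + 1) 1 ⟩
    length v + 1 ∸ 1                       ≡⟨ m+n∸n≡m (length v) 1 ⟩
    length v                               ∎

lemma9 : (k n i t : ℕ) → 3 ≤ k → 0 < i → i < n → 1 ≤ t →
           t + 1 ≤ length (W k n) →
           factor (W k n) t (t + 1) ≡ i ∷ 0 ∷ [] →
           (length (W k i) ≤ t)
           × (factor (W k n) (t ∸ length (W k i) + 1) (t + 1) ≡ W k i ++ 0 ∷ [])
lemma9 (suc c) n i (suc t) _ _ _ _ _ occurrence with factor-pair-split t (W (suc c) n) occurrence
... | p , s , W≡ , |p|≡t with W-suffix c n p W≡ (s≤s z≤n)
...   | q , ends =
  subst (length Wᵢ ≤_) (sym t≡) (m≤n+m (length Wᵢ) (length q)) ,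
  subst (λ ℓ → factor (W (suc c) n) (ℓ ∸ length Wᵢ + 1) (ℓ + 1) ≡ Wᵢ ∷ʳ 0) (sym t≡) (factor-at q Wᵢ W≡′)
  where
  open ≡-Reasoning
  Wᵢ : Word
  Wᵢ = W (suc c) i
  t≡ : suc t ≡ length q + length Wᵢ
  t≡ = begin
    suc t             ≡⟨ cong suc |p|≡t ⟨
    suc (length p)    ≡⟨ +-comm (length p) 1 ⟨
    length p + 1      ≡⟨ length-++ p ⟨
    length (p ∷ʳ i)   ≡⟨ cong length ends ⟩
    length (q ++ Wᵢ)  ≡⟨ length-++ q ⟩
    length q + length Wᵢ ∎
  W≡′ : W (suc c) n ≡ q ++ Wᵢ ++ 0 ∷ s
  W≡′ = begin
    W (suc c) n         ≡⟨ W≡ ⟩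
    p ++ i ∷ 0 ∷ s      ≡⟨ ++-assoc p (i ∷ []) (0 ∷ s) ⟨
    p ∷ʳ i ++ 0 ∷ s     ≡⟨ cong (_++ 0 ∷ s) ends ⟩
    (q ++ Wᵢ) ++ 0 ∷ s  ≡⟨ ++-assoc q Wᵢ (0 ∷ s) ⟩
    q ++ Wᵢ ++ 0 ∷ s    ∎
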